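{- Let $n \ge 2$ and $N = n \cdot n!$. The string $\coprod(n) = a_0 a_1 \cdots a_{N-1}$ is a multiversal cycle for the $(n-1)$-permutations of $\{1,\ldots,n\}$; that is, regarding it as circular (indices modulo $N$), for every $m \in \{0,1,\ldots,n-1\}$, \[ \{ a_{m+in}\, a_{m+in+1} \cdots a_{m+in+n-2} \mid i = 1,2,\ldots,n! \} = \mathbb{S}_{n-1,n}, \] the set of all $(n-1)$-permutations of $\{1,\ldots,n\}$ (sequences of $n-1$ distinct elements of $\{1,\ldots,n\}$).
   Context: Permutations are written in one-line notation, and for $1 \le k \le n$ the operation $\sigma_k = (1\ 2\ \cdots\ k)$ acts on positions: $\sigma_k(x_1 x_2 \cdots x_n) = x_2 \cdots x_k\, x_1\, x_{k+1}\cdots x_n$. The circular list $\Pi(n) = \Pi(n)_0, \Pi(n)_1, \ldots, \Pi(n)_{n!-1}$ of permutations of $\{1,\ldots,n\}$ is defined recursively: $\Pi(1) = 1$; $\Pi(2) = 21, 12$; $\Pi(3) = 321, 213, 132, 312, 123, 231$; and for $n \ge 4$, for each $j = 0, \ldots, (n-1)!-1$, with $\pi = \Pi(n-1)_j$, set $\Pi(n)_{jn} = n\pi$ (the symbol $n$ followed by $\pi$) and let $\Pi(n)_{jn+1}, \ldots, \Pi(n)_{jn+n-1}$ be, in order, $\sigma_n(n\pi),\ \sigma_n^2(n\pi),\ \sigma_{n-1}(\sigma_n^2(n\pi)),\ \ldots,\ \sigma_{n-1}^{n-3}(\sigma_n^2(n\pi))$. The flattening $\coprod(n)$ is the string of length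 $n\cdot n!$ obtained by concatenating $\Pi(n)_0, \ldots, \Pi(n)_{n!-1}$, each written as a word of length $n$. -}

module Defs where

open import Data.Nat using (ℕ; zero; suc; _+_; _*_; _∸_; _≤_; _%_; _!)

open import Data.List using (List; []; _∷_; [_]; _++_; take; drop; concat; concatMap; map; length; upTo)
open import Data.List.Relation.Unary.All using (All)
open import Data.List.Relation.Unary.Unique.Propositional using (Unique)
open import Data.Product using (_×_)
open import Relation.Binary.PropositionalEquality using (_≡_)

-- σ_k = (1 2 ... k) acting on positions: x1 x2 ... xn ↦ x2 ... xk x1 x(k+1) ... xn
σ : ℕ → List ℕ → List ℕ
σ k xs = drop 1 (take k xs) ++ take 1 (take k xs) ++ drop k xs

iter : {A : Set} → ℕ → (A → A) → A → A
iter zero    f x = x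
iter (suc j) f x = f (iter j f x)

-- the n consecutive entries of Π(n) coming from π = Π(n-1)_j :
-- nπ, σ_n(nπ), σ_n²(nπ), σ_{n-1}(σ_n²(nπ)), …, σ_{n-1}^{n-3}(σ_n²(nπ))
block : ℕ → List ℕ → List (List ℕ)
block n π =
  (n ∷ π) ∷ σ n (n ∷ π) ∷
    map (λ t → iter t (σ (n ∸ 1)) (iter 2 (σ n) (n ∷ π))) (upTo (n ∸ 2))

-- the list Π(n)   (Π(0) is an irrelevant placeholder)
Π : ℕ → List (List ℕ)
Π zero = [ [] ]
Π (suc zero) = [ 1 ∷ [] ]
Π (suc (suc zero)) = (2 ∷ 1 ∷ []) ∷ (1 ∷ 2 ∷ []) ∷ []
Π (suc (suc (suc zero))) =
  (3 ∷ 2 ∷ 1 ∷ []) ∷ (2 ∷ 1 ∷ 3 ∷ []) ∷ (1 ∷ 3 ∷ 2 ∷ []) ∷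
  (3 ∷ 1 ∷ 2 ∷ []) ∷ (1 ∷ 2 ∷ 3 ∷ []) ∷ (2 ∷ 3 ∷ 1 ∷ []) ∷ []
Π (suc (suc (suc (suc k)))) = concatMap (block (4 + k)) (Π (suc (suc (suc k))))

flat : ℕ → List ℕ
flat n = concat (Π n)

-- list lookup with default 0 (only used at indices < length)
nth : List ℕ → ℕ → ℕ
nth []       _       = 0
nth (x ∷ xs) zero    = x
nth (x ∷ xs) (suc j) = nth xs j

circ : List ℕ → ℕ → ℕ
circ xs j with length xs
... | zero  = 0
... | suc L = nth xs (j % suc L)

window : List ℕ → ℕ → ℕ → List ℕ
window xs s len = map (λ t → circ xs (s + t)) (upTo len)

windows : ℕ → ℕ → List (List ℕ)
windows n m = map (λ i → window (flat n) (m + i * n) (n ∸ 1)) (map suc (upTo (n !)))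

IsKPerm : ℕ → ℕ → List ℕ → Set
IsKPerm k n w = (length w ≡ k) × All (λ x → 1 ≤ x × x ≤ n) w × Unique w

-- Consecutive entries of the cyclic list Π(n) differ by σ_n or σ_(n-1) (by induction through its blocks), so
-- either way the successor of an entry x begins with x₂ ⋯ x_(n-1). Hence the window of length n - 1 at offset m
-- inside x is x₁ ⋯ x_(n-1) for m = 0, and the rotation x_(m+1) ⋯ x_n x₂ ⋯ x_m of x₂ ⋯ x_n otherwise. Each of
-- these maps sends the permutations of {1, …, n} onto the (n - 1)-permutations (extend by the missing symbol),
-- and the windows for i = 1, …, n! start in every entry of Π(n), whose entries are exactly the permutations.

module Submission where

open import Data.Nat using (ℕ; zero; suc; _+_; _*_; _∸_; _≤_; _<_; z≤n; s≤s; s≤s⁻¹; _!; _≟_; _%_; _<?_)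
open import Data.Nat.DivMod using (m<n⇒m%n≡m; [m+n]%n≡m%n)
open import Data.Nat.Properties
open import Data.List
  using (List; []; _∷_; [_]; _++_; _∷ʳ_; take; drop; concat; concatMap; map; length; upTo; applyUpTo;
         initLast; _∷ʳ′_)
open import Data.List.Properties
  using (++-assoc; ++-identityʳ; length-++; take++drop≡id; take-take; length-take; length-applyUpTo;
         length-map; length-upTo; map-upTo; ∷ʳ-++; length-drop; drop-drop; drop-[]; concat-++)
open import Data.List.Relation.Unary.All as All using (All; []; _∷_)
open import Data.List.Relation.Unary.All.Properties.Core using (¬Any⇒All¬)
open import Data.List.Relation.Unary.All.Properties
  using (¬All⇒Any¬; ++⁺; concat⁺; map⁺; applyUpTo⁺₂; take⁺; drop⁺)
open import Data.List.Relation.Unary.Any as Any using (here; there)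
open import Data.List.Relation.Unary.Any.Properties using (applyUpTo⁻)
open import Data.List.Relation.Unary.AllPairs using ([]; _∷_)
open import Data.List.Relation.Unary.Linked as Linked using (Linked; []; [-]; _∷_)
open import Data.List.Relation.Unary.Unique.Propositional using (Unique)
import Data.List.Relation.Unary.Unique.Propositional.Properties as Unique
open import Data.List.Relation.Binary.Permutation.Propositional
  using (_↭_; ↭-refl; ↭-prep; ↭-sym; ↭-trans; ↭-reflexive; ↭⇒↭ₛ; module PermutationReasoning)
open import Data.List.Relation.Binary.Permutation.Propositional.Properties
  using (All-resp-↭; ↭-length; ++⁺ʳ; shift; ∈-resp-↭) renaming (++-comm to ↭-++-comm)
open import Data.List.Relation.Binary.Subset.Propositional using (_⊆_)
open import Data.List.Membership.Propositional using (_∈_; _∉_)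
open import Data.List.Membership.Propositional.Properties
  using (∈-∃++; ∈-applyUpTo⁺; ∈-concatMap⁺; ∈-map⁺; ∈-map⁻; ∈-upTo⁺; ∈-upTo⁻)
open import Data.List.Membership.DecPropositional _≟_ using (_∈?_)
open import Data.Product using (_×_; _,_; ∃; ∃₂; proj₁; proj₂)
open import Data.Sum using (_⊎_; inj₁; inj₂)
open import Relation.Binary.PropositionalEquality
  using (_≡_; _≢_; refl; sym; trans; cong; cong₂; subst; subst₂; module ≡-Reasoning)
  renaming (setoid to ≡-setoid)
open import Data.List.Relation.Binary.Permutation.Setoid.Properties (≡-setoid ℕ) using (Unique-resp-↭)
open import Relation.Nullary using (yes; no; contradiction)
open import Function using (_∘_; id)

open import Defs

private variable
  A : Set
  R : A → A → Set
  x : A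
  xs ys zs : List A
  i j k n : ℕ

take-length-++ : (xs ys : List A) → take (length xs) (xs ++ ys) ≡ xs
take-length-++ []       ys = refl
take-length-++ (x ∷ xs) ys = cong (x ∷_) (take-length-++ xs ys)

drop-length-++ : (xs ys : List A) → drop (length xs) (xs ++ ys) ≡ ys
drop-length-++ []       ys = refl
drop-length-++ (x ∷ xs) ys = drop-length-++ xs ys

take-length-+-++ : (xs ys : List A) (j : ℕ) → take (length xs + j) (xs ++ ys) ≡ xs ++ take j ys
take-length-+-++ []       ys j = refl
take-length-+-++ (x ∷ xs) ys j = cong (x ∷_) (take-length-+-++ xs ys j)

take-++-≤ : ∀ j (xs ys : List A) → j ≤ length xs → take j (xs ++ ys) ≡ take j xs
take-++-≤ zero    xs       ys _        = refl
take-++-≤ (suc j) (x ∷ xs) ys (s≤s j≤) = cong (x ∷_) (take-++-≤ j xs ys j≤)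

drop-++-≤ : ∀ j (xs ys : List A) → j ≤ length xs → drop j (xs ++ ys) ≡ drop j xs ++ ys
drop-++-≤ zero    xs       ys _        = refl
drop-++-≤ (suc j) (x ∷ xs) ys (s≤s j≤) = drop-++-≤ j xs ys j≤

take-take-≤ : (xs : List A) → i ≤ j → take i (take j xs) ≡ take i xs
take-take-≤ {i = i} xs i≤j = trans (take-take i _ xs) (cong (λ l → take l xs) (m≤n⇒m⊓n≡m i≤j))

length-take-≤ : (xs : List A) → j ≤ length xs → length (take j xs) ≡ j
length-take-≤ {j = j} xs j≤ = trans (length-take j xs) (m≤n⇒m⊓n≡m j≤)

length-∷ʳ : (xs : List A) (x : A) → length (xs ∷ʳ x) ≡ suc (length xs)
length-∷ʳ xs x = trans (length-++ xs) (+-comm (length xs) 1)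

take-≡-≤ : (xs ys : List A) → i ≤ j → take j xs ≡ take j ys → take i xs ≡ take i ys
take-≡-≤ xs ys i≤j eq = trans (sym (take-take-≤ xs i≤j)) (trans (cong (take _) eq) (take-take-≤ ys i≤j))

take-++-cong : (zs : List A) → take j xs ≡ take j ys → take j (zs ++ xs) ≡ take j (zs ++ ys)
take-++-cong          []       eq = eq
take-++-cong {j = zero} (z ∷ zs) eq = refl
take-++-cong {j = suc j} {xs = xs} {ys} (z ∷ zs) eq =
  cong (z ∷_) (take-++-cong zs (take-≡-≤ xs ys (n≤1+n j) eq))

take-suc-++-cong : (zs : List A) → 0 < length zs → take j xs ≡ take j ys →
  take (suc j) (zs ++ xs) ≡ take (suc j) (zs ++ ys)
take-suc-++-cong (z ∷ zs) _ eq = cong (z ∷_) (take-++-cong zs eq)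

length-concat : (xss : List (List A)) → All (λ xs → length xs ≡ n) xss → length (concat xss) ≡ length xss * n
length-concat []         []           = refl
length-concat (xs ∷ xss) (len ∷ lens) = trans (length-++ xs) (cong₂ _+_ len (length-concat xss lens))

rotate : List A → List A
rotate []       = []
rotate (x ∷ xs) = xs ∷ʳ x

length-rotate : (xs : List A) → length (rotate xs) ≡ length xs
length-rotate []       = refl
length-rotate (x ∷ xs) = length-∷ʳ xs x

length-iter-rotate : (t : ℕ) (xs : List A) → length (iter t rotate xs) ≡ length xs
length-iter-rotate zero    xs = refl
length-iter-rotate (suc t) xs = trans (length-rotate (iter t rotate xs)) (length-iter-rotate t xs)

iter-suc : (t : ℕ) (f : A → A) (x : A) → iter (suc t) f x ≡ iter t f (f x)
iter-suc zero    f x = refl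
iter-suc (suc t) f x = cong f (iter-suc t f x)

iter-rotate-++ : (xs ys : List A) → iter (length xs) rotate (xs ++ ys) ≡ ys ++ xs
iter-rotate-++ []       ys = sym (++-identityʳ ys)
iter-rotate-++ (x ∷ xs) ys = begin
  iter (suc (length xs)) rotate (x ∷ xs ++ ys)  ≡⟨ iter-suc (length xs) rotate (x ∷ xs ++ ys) ⟩
  iter (length xs) rotate ((xs ++ ys) ∷ʳ x)     ≡⟨ cong (iter (length xs) rotate) (++-assoc xs ys [ x ]) ⟩
  iter (length xs) rotate (xs ++ ys ∷ʳ x)       ≡⟨ iter-rotate-++ xs (ys ∷ʳ x) ⟩
  (ys ∷ʳ x) ++ xs                               ≡⟨ ++-assoc ys [ x ] xs ⟩
  ys ++ x ∷ xs                                  ∎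
  where open ≡-Reasoning

σ-++ : (xs ys : List ℕ) → length xs ≡ k → σ k (xs ++ ys) ≡ rotate xs ++ ys
σ-++ xs ys refl rewrite take-length-++ xs ys | drop-length-++ xs ys with xs
... | []     = refl
... | x ∷ xs = sym (++-assoc xs [ x ] ys)

σ-rotate : (xs : List ℕ) → length xs ≡ k → σ k xs ≡ rotate xs
σ-rotate {k} xs eq = begin
  σ k xs             ≡⟨ cong (σ k) (sym (++-identityʳ xs)) ⟩
  σ k (xs ++ [])     ≡⟨ σ-++ xs [] eq ⟩
  rotate xs ++ []    ≡⟨ ++-identityʳ (rotate xs) ⟩
  rotate xs          ∎
  where open ≡-Reasoning

iter-σ-++ : (t : ℕ) (xs ys : List ℕ) → length xs ≡ k → iter t (σ k) (xs ++ ys) ≡ iter t rotate xs ++ ys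
iter-σ-++ zero    xs ys eq = refl
iter-σ-++ {k} (suc t) xs ys eq = trans (cong (σ k) (iter-σ-++ t xs ys eq))
  (σ-++ (iter t rotate xs) ys (trans (length-iter-rotate t xs) eq))

σ-↭ : (k : ℕ) (xs : List ℕ) → σ k xs ↭ xs
σ-↭ k xs = begin
  drop 1 hd ++ take 1 hd ++ drop k xs   ≡⟨ sym (++-assoc (drop 1 hd) (take 1 hd) (drop k xs)) ⟩
  (drop 1 hd ++ take 1 hd) ++ drop k xs  ↭⟨ ++⁺ʳ (drop k xs) (↭-++-comm (drop 1 hd) (take 1 hd)) ⟩
  (take 1 hd ++ drop 1 hd) ++ drop k xs  ≡⟨ cong (_++ drop k xs) (take++drop≡id 1 hd) ⟩
  hd ++ drop k xs                        ≡⟨ take++drop≡id k xs ⟩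
  xs                                     ∎
  where
    open PermutationReasoning
    hd = take k xs

iter-σ-↭ : (t k : ℕ) (xs : List ℕ) → iter t (σ k) xs ↭ xs
iter-σ-↭ zero    k xs = ↭-refl
iter-σ-↭ (suc t) k xs = ↭-trans (σ-↭ k (iter t (σ k) xs)) (iter-σ-↭ t k xs)

IsKPerm-resp-↭ : {xs ys : List ℕ} → xs ↭ ys → IsKPerm k n xs → IsKPerm k n ys
IsKPerm-resp-↭ p (len , bounds , unique) =
  trans (sym (↭-length p)) len , All-resp-↭ p bounds , Unique-resp-↭ (↭⇒↭ₛ p) unique

Unique-⊆⇒length-≤ : Unique xs → xs ⊆ ys → length xs ≤ length ys
Unique-⊆⇒length-≤ {xs = []}     _              _    = z≤n
Unique-⊆⇒length-≤ {xs = x ∷ xs} (x∉xs ∷ unique) x∷xs⊆ys with ∈-∃++ (x∷xs⊆ys (here refl))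
... | ys₁ , ys₂ , refl = subst (suc (length xs) ≤_) (sym (↭-length (shift x ys₁ ys₂)))
  (s≤s (Unique-⊆⇒length-≤ unique xs⊆ys₁++ys₂))
  where
    xs⊆ys₁++ys₂ : xs ⊆ ys₁ ++ ys₂
    xs⊆ys₁++ys₂ e∈xs with ∈-resp-↭ (shift x ys₁ ys₂) (x∷xs⊆ys (there e∈xs))
    ... | here e≡x = contradiction (sym e≡x) (All.lookup x∉xs e∈xs)
    ... | there e∈ = e∈

oneTo : ℕ → List ℕ
oneTo n = applyUpTo suc n

length-oneTo : (n : ℕ) → length (oneTo n) ≡ n
length-oneTo n = length-applyUpTo suc n

∈-oneTo : {c : ℕ} → 1 ≤ c → c ≤ n → c ∈ oneTo n
∈-oneTo {c = suc c} _ c<n = ∈-applyUpTo⁺ suc c<n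

oneTo-unique : (n : ℕ) → Unique (oneTo n)
oneTo-unique n = Unique.applyUpTo⁺₁ suc n (λ i<j _ → <⇒≢ i<j ∘ suc-injective)

bounded-Unique⇒length-≤ : {xs : List ℕ} → Unique xs → All (λ x → 1 ≤ x × x ≤ n) xs → length xs ≤ n
bounded-Unique⇒length-≤ {n} unique bounds = subst (_ ≤_) (length-oneTo n)
  (Unique-⊆⇒length-≤ unique (λ x∈xs → let 1≤x , x≤n = All.lookup bounds x∈xs in ∈-oneTo 1≤x x≤n))

IsKPerm⇒∋max : {xs : List ℕ} → IsKPerm (suc n) (suc n) xs → suc n ∈ xs
IsKPerm⇒∋max {n} {xs} (len , bounds , unique) with suc n ∈? xs
... | yes n∈xs = n∈xs
... | no  n∉xs =
  contradiction (subst (_≤ n) len (bounded-Unique⇒length-≤ unique (All.tabulate below))) (n≮n n)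
  where
    below : ∀ {x} → x ∈ xs → 1 ≤ x × x ≤ n
    below {x} x∈xs = let 1≤x , x≤1+n = All.lookup bounds x∈xs in
      1≤x , s≤s⁻¹ (≤∧≢⇒< x≤1+n λ { refl → n∉xs x∈xs })

IsKPerm⇒missing : {w : List ℕ} → IsKPerm n (suc n) w → ∃ λ c → (1 ≤ c × c ≤ suc n) × c ∉ w
IsKPerm⇒missing {n} {w} (len , _ , unique) with All.all? (_∈? w) (oneTo (suc n))
... | yes all∈ = contradiction
  (subst₂ _≤_ (length-oneTo (suc n)) len (Unique-⊆⇒length-≤ (oneTo-unique (suc n)) (All.lookup all∈)))
  (n≮n n)
... | no ¬all∈ with applyUpTo⁻ suc (¬All⇒Any¬ (_∈? w) (oneTo (suc n)) ¬all∈)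
...   | i , i<1+n , i+1∉w = suc i , (s≤s z≤n , i<1+n) , i+1∉w

Linked-∷ʳ-++ : (xs : List A) {y : A} {ys : List A} →
  Linked R (xs ∷ʳ y) → Linked R (y ∷ ys) → Linked R (xs ++ y ∷ ys)
Linked-∷ʳ-++ []            _            y∷ys = y∷ys
Linked-∷ʳ-++ (x ∷ [])      (r ∷ [-])    y∷ys = r ∷ y∷ys
Linked-∷ʳ-++ (x ∷ x′ ∷ xs) (r ∷ linked) y∷ys = r ∷ Linked-∷ʳ-++ (x′ ∷ xs) linked y∷ys

Linked-++⁻ˡ : (xs : List A) {ys : List A} → Linked R (xs ++ ys) → Linked R xs
Linked-++⁻ˡ []            _            = []
Linked-++⁻ˡ (x ∷ [])      _            = [-]
Linked-++⁻ˡ (x ∷ x′ ∷ xs) (r ∷ linked) = r ∷ Linked-++⁻ˡ (x′ ∷ xs) linked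

Linked-applyUpTo-∷ʳ : (f : ℕ → A) (m : ℕ) {y : A} →
  (∀ t → R (f t) (f (suc t))) → R (f m) y → Linked R (applyUpTo f (suc m) ∷ʳ y)
Linked-applyUpTo-∷ʳ f zero    steps last = last ∷ [-]
Linked-applyUpTo-∷ʳ f (suc m) steps last = steps 0 ∷ Linked-applyUpTo-∷ʳ (f ∘ suc) m (steps ∘ suc) last

LinkedCyclic : (A → A → Set) → List A → Set
LinkedCyclic R xs = Linked R (xs ++ take 1 xs)

∈-drop : (i : ℕ) (xs : List A) → x ∈ drop i xs → x ∈ xs
∈-drop zero    xs       x∈ = x∈
∈-drop (suc i) (y ∷ xs) x∈ = there (∈-drop i xs x∈)

Linked-drop : (i : ℕ) → Linked R xs → Linked R (drop i xs)
Linked-drop         zero    linked = linked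
Linked-drop {xs = []}     (suc i) _      = []
Linked-drop {xs = x ∷ xs} (suc i) linked = Linked-drop i (Linked.tail linked)

LinkedCyclic⇒Linked-++ : (xs : List A) → LinkedCyclic R xs → Linked R (xs ++ xs)
LinkedCyclic⇒Linked-++ []       _      = []
LinkedCyclic⇒Linked-++ (x ∷ xs) linked = Linked-∷ʳ-++ (x ∷ xs) linked (Linked-++⁻ˡ (x ∷ xs) linked)

drop-suc-++-self : (xs : List A) → i < length xs →
  ∃₂ λ x rest → drop (suc i) (xs ++ xs) ≡ x ∷ rest × x ∈ xs
drop-suc-++-self {i = i} xs i<len with drop (suc i) xs in eq
drop-suc-++-self {i = i} (x ∷ xs) i<len | [] =
  x , xs , trans (drop-++-≤ (suc i) (x ∷ xs) (x ∷ xs) i<len) (cong (_++ x ∷ xs) eq) , here refl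
drop-suc-++-self {i = i} xs       i<len | y ∷ ys =
  y , ys ++ xs , trans (drop-++-≤ (suc i) xs xs i<len) (cong (_++ xs) eq) ,
  ∈-drop (suc i) xs (subst (y ∈_) (sym eq) (here refl))

-- The head of xs is reached only in the second copy, at suc i = length xs.
∈⇒drop-suc-++-self : {xs : List A} → x ∈ xs →
  ∃ λ i → i < length xs × ∃ λ rest → drop (suc i) (xs ++ xs) ≡ x ∷ rest
∈⇒drop-suc-++-self x∈xs with ∈-∃++ x∈xs
... | [] , ys , refl = length ys , ≤-refl , ys , drop-length-++ ys (_ ∷ ys)
... | y ∷ ys , zs , refl = length ys ,
  s≤s (≤-trans (m≤m+n (length ys) (suc (length zs))) (≤-reflexive (sym (length-++ ys)))) ,
  zs ++ y ∷ ys ++ _ ∷ zs ,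
  trans (cong (drop (length ys)) (++-assoc ys (_ ∷ zs) (y ∷ ys ++ _ ∷ zs))) (drop-length-++ ys _)

length-≤-drop-suc-++-self : (xs : List A) → i < length xs → length xs ≤ length (drop (suc i) (xs ++ xs))
length-≤-drop-suc-++-self {i = i} xs i<len = begin
  length xs                           ≡⟨ sym (m+n∸n≡m (length xs) (length xs)) ⟩
  length xs + length xs ∸ length xs   ≤⟨ ∸-monoʳ-≤ (length xs + length xs) i<len ⟩
  length xs + length xs ∸ suc i       ≡⟨ cong (_∸ suc i) (sym (length-++ xs)) ⟩
  length (xs ++ xs) ∸ suc i           ≡⟨ sym (length-drop (suc i) (xs ++ xs)) ⟩
  length (drop (suc i) (xs ++ xs))    ∎
  where open ≤-Reasoning

LinkedCyclic-drop-suc : (xs : List A) {rest : List A} → LinkedCyclic R xs → 2 ≤ length xs → i < length xs →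
  drop (suc i) (xs ++ xs) ≡ x ∷ rest → ∃₂ λ y rest′ → rest ≡ y ∷ rest′ × R x y
LinkedCyclic-drop-suc {i = i} xs {rest} cyclic 2≤len i<len eq
  with rest | subst (Linked _) eq (Linked-drop (suc i) (LinkedCyclic⇒Linked-++ xs cyclic))
            | subst (λ zs → 2 ≤ length zs) eq (≤-trans 2≤len (length-≤-drop-suc-++-self xs i<len))
... | []        | _        | s≤s ()
... | y ∷ rest′ | step ∷ _ | _ = y , rest′ , refl , step

nth-++ˡ : (xs ys : List ℕ) (j : ℕ) → j < length xs → nth (xs ++ ys) j ≡ nth xs j
nth-++ˡ (x ∷ xs) ys zero    _        = refl
nth-++ˡ (x ∷ xs) ys (suc j) (s≤s j<) = nth-++ˡ xs ys j j<

nth-++ʳ : (xs ys : List ℕ) (j : ℕ) → nth (xs ++ ys) (length xs + j) ≡ nth ys j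
nth-++ʳ []       ys j = refl
nth-++ʳ (x ∷ xs) ys j = nth-++ʳ xs ys j

circ-++ : (xs : List ℕ) (j : ℕ) → j < length xs + length xs → circ xs j ≡ nth (xs ++ xs) j
circ-++ xs j j<2L with length xs in len
... | zero  = contradiction j<2L λ ()
... | suc L with j <? suc L
...   | yes j<L = trans (cong (nth xs) (m<n⇒m%n≡m j<L)) (sym (nth-++ˡ xs xs j (subst (j <_) (sym len) j<L)))
...   | no  j≮L = begin
  nth xs (j % suc L)
    ≡⟨ cong (λ i → nth xs (i % suc L)) (sym d+L≡j) ⟩
  nth xs ((d + suc L) % suc L)
    ≡⟨ cong (nth xs) ([m+n]%n≡m%n d (suc L)) ⟩
  nth xs (d % suc L)
    ≡⟨ cong (nth xs) (m<n⇒m%n≡m d<L) ⟩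
  nth xs d
    ≡⟨ sym (nth-++ʳ xs xs d) ⟩
  nth (xs ++ xs) (length xs + d)
    ≡⟨ cong (nth (xs ++ xs)) (trans (cong (_+ d) len) (trans (+-comm (suc L) d) d+L≡j)) ⟩
  nth (xs ++ xs) j ∎
  where
    open ≡-Reasoning
    d = j ∸ suc L
    d+L≡j : d + suc L ≡ j
    d+L≡j = m∸n+n≡m (≮⇒≥ j≮L)
    d<L : d < suc L
    d<L = +-cancelʳ-< (suc L) d (suc L) (subst (_< suc L + suc L) (sym d+L≡j) j<2L)

drop-nth : (s : ℕ) (xs : List ℕ) → s < length xs → drop s xs ≡ nth xs s ∷ drop (suc s) xs
drop-nth zero    (x ∷ xs) _        = refl
drop-nth (suc s) (x ∷ xs) (s≤s s<) = drop-nth s xs s<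

applyUpTo-nth : (f : ℕ → ℕ) (len s : ℕ) (xs : List ℕ) → (∀ t → t < len → f t ≡ nth xs (s + t)) →
  s + len ≤ length xs → applyUpTo f len ≡ take len (drop s xs)
applyUpTo-nth f zero      s xs _ _ = refl
applyUpTo-nth f (suc len) s xs f≡ bound
  rewrite drop-nth s xs (<-≤-trans (m<m+n s (s≤s z≤n)) bound) =
  cong₂ _∷_ (trans (f≡ 0 (s≤s z≤n)) (cong (nth xs) (+-identityʳ s)))
            (applyUpTo-nth (f ∘ suc) len (suc s) xs
              (λ t t< → trans (f≡ (suc t) (s≤s t<)) (cong (nth xs) (+-suc s t)))
              (≤-trans (≤-reflexive (sym (+-suc s len))) bound))

window-take-drop : (xs : List ℕ) (s len : ℕ) → s + len ≤ length xs + length xs →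
  window xs s len ≡ take len (drop s (xs ++ xs))
window-take-drop xs s len bound = trans (map-upTo (λ t → circ xs (s + t)) len)
  (applyUpTo-nth (λ t → circ xs (s + t)) len s (xs ++ xs)
    (λ t t<len → circ-++ xs (s + t) (<-≤-trans (+-monoʳ-< s t<len) bound))
    (≤-trans bound (≤-reflexive (sym (length-++ xs)))))

drop-*-concat : (i : ℕ) (xss : List (List A)) → All (λ xs → length xs ≡ n) xss →
  drop (i * n) (concat xss) ≡ concat (drop i xss)
drop-*-concat         zero    xss        _            = refl
drop-*-concat {n = n} (suc i) []         _            = drop-[] (n + i * n)
drop-*-concat {n = n} (suc i) (xs ∷ xss) (refl ∷ lens) = begin
  drop (length xs + i * length xs) (xs ++ concat xss)
    ≡⟨ sym (drop-drop (length xs) (i * length xs) (xs ++ concat xss)) ⟩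
  drop (i * length xs) (drop (length xs) (xs ++ concat xss))
    ≡⟨ cong (drop (i * length xs)) (drop-length-++ xs (concat xss)) ⟩
  drop (i * length xs) (concat xss)
    ≡⟨ drop-*-concat i xss lens ⟩
  concat (drop i xss) ∎
  where open ≡-Reasoning

Π-suc : (n : ℕ) → Π (suc (suc n)) ≡ concatMap (block (suc (suc n))) (Π (suc n))
Π-suc zero          = refl
Π-suc (suc zero)    = refl
Π-suc (suc (suc n)) = refl

entry : ℕ → List ℕ → ℕ → List ℕ
entry N π t = iter t (σ (N ∸ 1)) (iter 2 (σ N) (N ∷ π))

block-entries : (N : ℕ) (π : List ℕ) →
  block N π ≡ (N ∷ π) ∷ σ N (N ∷ π) ∷ applyUpTo (entry N π) (N ∸ 2)
block-entries N π = cong (λ es → (N ∷ π) ∷ σ N (N ∷ π) ∷ es) (map-upTo (entry N π) (N ∸ 2))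

length-block : (n : ℕ) (π : List ℕ) → length (block (suc (suc n)) π) ≡ suc (suc n)
length-block n π = cong (suc ∘ suc) (trans (length-map (entry (suc (suc n)) π) (upTo n)) (length-upTo n))

entry-rotate : (t p : ℕ) (P : List ℕ) → length P ≡ n →
  entry (suc (suc n)) (p ∷ P) t ≡ iter t rotate (P ∷ʳ suc (suc n)) ∷ʳ p
entry-rotate {n} t p P len = begin
  iter t (σ (suc n)) (σ N (σ N (N ∷ p ∷ P)))
    ≡⟨ cong (iter t (σ (suc n)) ∘ σ N) (σ-rotate (N ∷ p ∷ P) (cong (suc ∘ suc) len)) ⟩
  iter t (σ (suc n)) (σ N (p ∷ P ∷ʳ N))
    ≡⟨ cong (iter t (σ (suc n))) (σ-rotate (p ∷ P ∷ʳ N) (cong suc len′)) ⟩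
  iter t (σ (suc n)) ((P ∷ʳ N) ∷ʳ p)
    ≡⟨ iter-σ-++ t (P ∷ʳ N) [ p ] len′ ⟩
  iter t rotate (P ∷ʳ N) ∷ʳ p ∎
  where
    open ≡-Reasoning
    N = suc (suc n)
    len′ : length (P ∷ʳ N) ≡ suc n
    len′ = trans (length-∷ʳ P N) (cong suc len)

IsKPerm-max∷ : {π : List ℕ} → IsKPerm n n π → IsKPerm (suc n) (suc n) (suc n ∷ π)
IsKPerm-max∷ (len , bounds , unique) =
  cong suc len ,
  (s≤s z≤n , ≤-refl) ∷ All.map (λ (1≤x , x≤n) → 1≤x , m≤n⇒m≤1+n x≤n) bounds ,
  All.map (λ x≤n n+1≡x → <-irrefl (sym n+1≡x) (s≤s x≤n)) (All.map proj₂ bounds) ∷ unique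

block-↭ : (N : ℕ) (π : List ℕ) → All (_↭ N ∷ π) (block N π)
block-↭ N π = ↭-refl ∷ σ-↭ N (N ∷ π) ∷ map⁺ (applyUpTo⁺₂ id _ λ t →
  ↭-trans (iter-σ-↭ t (N ∸ 1) _) (iter-σ-↭ 2 N (N ∷ π)))

block-IsKPerm : {π : List ℕ} → IsKPerm n n π → All (IsKPerm (suc n) (suc n)) (block (suc n) π)
block-IsKPerm {n} {π} π-perm =
  All.map (λ e↭ → IsKPerm-resp-↭ (↭-sym e↭) (IsKPerm-max∷ π-perm)) (block-↭ (suc n) π)

Π-IsKPerm : (n : ℕ) → All (IsKPerm (suc n) (suc n)) (Π (suc n))
Π-IsKPerm zero    = (refl , (s≤s z≤n , s≤s z≤n) ∷ [] , [] ∷ []) ∷ []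
Π-IsKPerm (suc n) = subst (All (IsKPerm (suc (suc n)) (suc (suc n)))) (sym (Π-suc n))
  (concat⁺ (map⁺ (All.map block-IsKPerm (Π-IsKPerm n))))

length-Π : (n : ℕ) → length (Π (suc n)) ≡ suc n !
length-Π zero    = refl
length-Π (suc n) = begin
  length (Π N)
    ≡⟨ cong length (Π-suc n) ⟩
  length (concat (map (block N) (Π (suc n))))
    ≡⟨ length-concat (map (block N) (Π (suc n))) (map⁺ (All.tabulate λ {π} _ → length-block n π)) ⟩
  length (map (block N) (Π (suc n))) * N
    ≡⟨ cong (_* N) (trans (length-map (block N) (Π (suc n))) (length-Π n)) ⟩
  suc n ! * N
    ≡⟨ *-comm (suc n !) N ⟩
  N ! ∎
  where
    open ≡-Reasoning
    N = suc (suc n)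

-- Completeness of Π

IsKPerm-remove-max : {xs ys : List ℕ} → IsKPerm (suc n) (suc n) xs → xs ↭ suc n ∷ ys → IsKPerm n n ys
IsKPerm-remove-max xs-perm p with IsKPerm-resp-↭ p xs-perm
... | len , _ ∷ bounds , n+1∉ys ∷ unique = suc-injective len , below bounds n+1∉ys , unique
  where
    below : {ys : List ℕ} → All (λ x → 1 ≤ x × x ≤ suc n) ys → All (suc n ≢_) ys →
      All (λ x → 1 ≤ x × x ≤ n) ys
    below []                      []             = []
    below ((1≤x , x≤1+n) ∷ bounds) (n+1≢x ∷ ≢s) =
      (1≤x , s≤s⁻¹ (≤∧≢⇒< x≤1+n (n+1≢x ∘ sym))) ∷ below bounds ≢s

module _ {n : ℕ} where
  private
    N : ℕ
    N = suc (suc n)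

  ∷ʳ-∈-block : (π : List ℕ) → length π ≡ suc n → π ∷ʳ N ∈ block N π
  ∷ʳ-∈-block π len = there (here (sym (σ-rotate (N ∷ π) (cong suc len))))

  middle-∈-block : (a b : ℕ) (A B : List ℕ) → length (B ++ a ∷ A) ≡ n →
    (a ∷ A) ++ N ∷ (B ∷ʳ b) ∈ block N (b ∷ B ++ a ∷ A)
  middle-∈-block a b A B len =
    subst ((a ∷ A) ++ N ∷ (B ∷ʳ b) ∈_) (sym (block-entries N (b ∷ B ++ a ∷ A)))
      (there (there (subst (_∈ applyUpTo (entry N (b ∷ B ++ a ∷ A)) n) entry≡
        (∈-applyUpTo⁺ (entry N (b ∷ B ++ a ∷ A)) |B|<n))))
    where
      open ≡-Reasoning
      |B|<n : length B < n
      |B|<n = subst (length B <_) (trans (sym (length-++ B)) len) (m<m+n (length B) (s≤s z≤n))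
      entry≡ : entry N (b ∷ B ++ a ∷ A) (length B) ≡ (a ∷ A) ++ N ∷ (B ∷ʳ b)
      entry≡ = begin
        entry N (b ∷ B ++ a ∷ A) (length B)
          ≡⟨ entry-rotate (length B) b (B ++ a ∷ A) len ⟩
        iter (length B) rotate ((B ++ a ∷ A) ∷ʳ N) ∷ʳ b
          ≡⟨ cong (λ xs → iter (length B) rotate xs ∷ʳ b) (++-assoc B (a ∷ A) [ N ]) ⟩
        iter (length B) rotate (B ++ (a ∷ A) ∷ʳ N) ∷ʳ b
          ≡⟨ cong (_∷ʳ b) (iter-rotate-++ B ((a ∷ A) ∷ʳ N)) ⟩
        ((a ∷ A) ∷ʳ N ++ B) ∷ʳ b
          ≡⟨ ++-assoc ((a ∷ A) ∷ʳ N) B [ b ] ⟩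
        (a ∷ A) ∷ʳ N ++ B ∷ʳ b
          ≡⟨ ∷ʳ-++ (a ∷ A) N (B ∷ʳ b) ⟩
        (a ∷ A) ++ N ∷ (B ∷ʳ b) ∎

  ∈-blocks : {π x : List ℕ} {P : List (List ℕ)} → π ∈ P → x ∈ block N π → x ∈ concatMap (block N) P
  ∈-blocks π∈P x∈block = ∈-concatMap⁺ (block N) (Any.map (λ { refl → x∈block }) π∈P)

  -- x is located by the position of N: it is N ∷ π, π ∷ʳ N, or (a ∷ A) ++ N ∷ (B ∷ʳ b)
  -- with π = b ∷ B ++ a ∷ A.
  IsKPerm-∈-blocks : {x : List ℕ} {P : List (List ℕ)} → IsKPerm N N x →
    (∀ {π} → IsKPerm (suc n) (suc n) π → π ∈ P) → x ∈ concatMap (block N) P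
  IsKPerm-∈-blocks x-perm complete with ∈-∃++ (IsKPerm⇒∋max x-perm)
  ... | A , B , refl with initLast B
  ...   | [] = ∈-blocks (complete π-perm) (∷ʳ-∈-block A (proj₁ π-perm))
    where
      π-perm : IsKPerm (suc n) (suc n) A
      π-perm = IsKPerm-remove-max x-perm (↭-trans (shift N A []) (↭-reflexive (cong (N ∷_) (++-identityʳ A))))
  ...   | B ∷ʳ′ b with A
  ...     | [] = ∈-blocks (complete (IsKPerm-remove-max x-perm ↭-refl)) (here refl)
  ...     | a ∷ A′ = ∈-blocks (complete π-perm) (middle-∈-block a b A′ B (suc-injective (proj₁ π-perm)))
    where
      π-perm : IsKPerm (suc n) (suc n) (b ∷ B ++ a ∷ A′)
      π-perm = IsKPerm-resp-↭ rearrange (IsKPerm-remove-max x-perm (shift N (a ∷ A′) (B ∷ʳ b)))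
        where
          open PermutationReasoning
          rearrange : (a ∷ A′) ++ B ∷ʳ b ↭ b ∷ B ++ a ∷ A′
          rearrange = begin
            (a ∷ A′) ++ B ∷ʳ b  ↭⟨ ↭-++-comm (a ∷ A′) (B ∷ʳ b) ⟩
            (B ∷ʳ b) ++ a ∷ A′  ≡⟨ ∷ʳ-++ B b (a ∷ A′) ⟩
            B ++ b ∷ a ∷ A′     ↭⟨ shift b B (a ∷ A′) ⟩
            b ∷ B ++ a ∷ A′     ∎

Π-complete : (n : ℕ) {x : List ℕ} → IsKPerm (suc n) (suc n) x → x ∈ Π (suc n)
Π-complete zero    {a ∷ []} (_ , (_ , s≤s z≤n) ∷ [] , _) = here refl
Π-complete (suc n) {x}      x-perm =
  subst (x ∈_) (sym (Π-suc n)) (IsKPerm-∈-blocks x-perm (Π-complete n))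

-- Consecutive entries of Π

Step : ℕ → List ℕ → List ℕ → Set
Step n x y = y ≡ σ n x ⊎ y ≡ σ (n ∸ 1) x

module _ {k : ℕ} where
  private
    N : ℕ
    N = suc (suc (suc k))

  last-entry : (p a : ℕ) (P : List ℕ) → length P ≡ k → entry N (p ∷ P ∷ʳ a) k ≡ (a ∷ N ∷ P) ∷ʳ p
  last-entry p a P len = begin
    entry N (p ∷ P ∷ʳ a) k
      ≡⟨ entry-rotate k p (P ∷ʳ a) (trans (length-∷ʳ P a) (cong suc len)) ⟩
    iter k rotate ((P ∷ʳ a) ∷ʳ N) ∷ʳ p
      ≡⟨ cong (λ t → iter t rotate ((P ∷ʳ a) ∷ʳ N) ∷ʳ p) (sym len) ⟩
    iter (length P) rotate ((P ∷ʳ a) ∷ʳ N) ∷ʳ p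
      ≡⟨ cong (λ xs → iter (length P) rotate xs ∷ʳ p) (++-assoc P [ a ] [ N ]) ⟩
    iter (length P) rotate (P ++ a ∷ N ∷ []) ∷ʳ p
      ≡⟨ cong (_∷ʳ p) (iter-rotate-++ P (a ∷ N ∷ [])) ⟩
    (a ∷ N ∷ P) ∷ʳ p ∎
    where open ≡-Reasoning

  Step-last-entry : (p a : ℕ) (P : List ℕ) {q : List ℕ} → length P ≡ k →
    Step (suc (suc k)) (p ∷ P ∷ʳ a) q → Step N ((a ∷ N ∷ P) ∷ʳ p) (N ∷ q)
  Step-last-entry p a P len (inj₁ refl) = inj₂ (begin
    N ∷ σ (suc (suc k)) (p ∷ P ∷ʳ a)    ≡⟨ cong (N ∷_) (σ-rotate (p ∷ P ∷ʳ a) (cong suc len-P∷ʳa)) ⟩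
    N ∷ (P ∷ʳ a) ∷ʳ p                   ≡⟨ sym (σ-++ (a ∷ N ∷ P) [ p ] (cong (suc ∘ suc) len)) ⟩
    σ (suc (suc k)) ((a ∷ N ∷ P) ∷ʳ p)  ∎)
    where
      open ≡-Reasoning
      len-P∷ʳa : length (P ∷ʳ a) ≡ suc k
      len-P∷ʳa = trans (length-∷ʳ P a) (cong suc len)
  Step-last-entry p a P len (inj₂ refl) = inj₁ (begin
    N ∷ σ (suc k) ((p ∷ P) ∷ʳ a)  ≡⟨ cong (N ∷_) (σ-++ (p ∷ P) [ a ] (cong suc len)) ⟩
    N ∷ (P ∷ʳ p) ∷ʳ a             ≡⟨ sym (σ-rotate ((a ∷ N ∷ P) ∷ʳ p) len-last) ⟩
    σ N ((a ∷ N ∷ P) ∷ʳ p)        ∎)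
    where
      open ≡-Reasoning
      len-last : length ((a ∷ N ∷ P) ∷ʳ p) ≡ N
      len-last = trans (length-∷ʳ (a ∷ N ∷ P) p) (cong (suc ∘ suc ∘ suc) len)

  block-Linked : (π : List ℕ) {q : List ℕ} → length π ≡ suc (suc k) →
    Step (suc (suc k)) π q → Linked (Step N) (block N π ∷ʳ (N ∷ q))
  block-Linked (p ∷ π′) {q} len step with initLast π′
  block-Linked (p ∷ _) () _ | []
  ... | P ∷ʳ′ a = subst (λ es → Linked (Step N) (es ∷ʳ (N ∷ q))) (sym (block-entries N (p ∷ P ∷ʳ a)))
    (inj₁ refl ∷ inj₁ refl ∷ Linked-applyUpTo-∷ʳ (entry N (p ∷ P ∷ʳ a)) k (λ _ → inj₂ refl)
      (subst (λ e → Step N e (N ∷ q)) (sym (last-entry p a P lenP)) (Step-last-entry p a P lenP step)))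
    where
      lenP : length P ≡ k
      lenP = suc-injective (trans (sym (length-∷ʳ P a)) (suc-injective len))

  blocks-Linked : (π : List ℕ) (πs : List (List ℕ)) {q : List ℕ} →
    All (λ x → length x ≡ suc (suc k)) (π ∷ πs) → Linked (Step (suc (suc k))) (π ∷ πs ∷ʳ q) →
    Linked (Step N) (concatMap (block N) (π ∷ πs) ∷ʳ (N ∷ q))
  blocks-Linked π [] {q} (len ∷ []) (step ∷ [-]) =
    subst (λ es → Linked (Step N) (es ∷ʳ (N ∷ q))) (sym (++-identityʳ (block N π))) (block-Linked π len step)
  blocks-Linked π (π′ ∷ πs) {q} (len ∷ lens) (step ∷ linked) =
    subst (Linked (Step N)) (sym (++-assoc (block N π) (concatMap (block N) (π′ ∷ πs)) [ N ∷ q ]))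
      (Linked-∷ʳ-++ (block N π) (block-Linked π len step) (blocks-Linked π′ πs lens linked))

  blocks-LinkedCyclic : (πs : List (List ℕ)) → All (λ x → length x ≡ suc (suc k)) πs →
    LinkedCyclic (Step (suc (suc k))) πs → LinkedCyclic (Step N) (concatMap (block N) πs)
  blocks-LinkedCyclic []       _    _      = []
  blocks-LinkedCyclic (π ∷ πs) lens linked = blocks-Linked π πs lens linked

Π-LinkedCyclic : (n : ℕ) → LinkedCyclic (Step (suc (suc n))) (Π (suc (suc n)))
Π-LinkedCyclic zero    = inj₁ refl ∷ inj₁ refl ∷ [-]
Π-LinkedCyclic (suc k) = subst (LinkedCyclic (Step (suc (suc (suc k))))) (sym (Π-suc (suc k)))
  (blocks-LinkedCyclic (Π (suc (suc k))) (All.map proj₁ (Π-IsKPerm (suc k))) (Π-LinkedCyclic k))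

-- The window of length k + 1 at offset m < k + 2 inside an entry x whose successor begins with take k (drop 1 x).
segment : ℕ → ℕ → List ℕ → List ℕ
segment k m x = take (suc k) (drop m x ++ take k (drop 1 x))

Step-take : (a : ℕ) (x y : List ℕ) → length x ≡ suc k → Step (suc (suc k)) (a ∷ x) y →
  take k y ≡ take k x
Step-take {k} a x y len (inj₁ refl) = begin
  take k (σ (suc (suc k)) (a ∷ x))  ≡⟨ cong (take k) (σ-rotate (a ∷ x) (cong suc len)) ⟩
  take k (x ∷ʳ a)                   ≡⟨ take-++-≤ k x [ a ] (≤-trans (n≤1+n k) (≤-reflexive (sym len))) ⟩
  take k x                          ∎
  where open ≡-Reasoning
Step-take {k} a x y len (inj₂ refl) = begin
  take k (take k x ++ a ∷ drop k x)       ≡⟨ take-++-≤ k (take k x) _ (≤-reflexive (sym (length-take-≤ x k≤len))) ⟩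
  take k (take k x)                       ≡⟨ take-take-≤ x ≤-refl ⟩
  take k x                                ∎
  where
    open ≡-Reasoning
    k≤len : k ≤ length x
    k≤len = ≤-trans (n≤1+n k) (≤-reflexive (sym len))

take-drop-Step : (m : ℕ) → m < suc (suc k) → (x y rest : List ℕ) → length x ≡ suc (suc k) →
  length y ≡ suc (suc k) → Step (suc (suc k)) x y → take (suc k) (drop m (x ++ y ++ rest)) ≡ segment k m x
take-drop-Step {k} m m<n (a ∷ x) y rest len len-y step = begin
  take (suc k) (drop m ((a ∷ x) ++ y ++ rest))
    ≡⟨ cong (take (suc k)) (drop-++-≤ m (a ∷ x) (y ++ rest) (≤-trans (<⇒≤ m<n) (≤-reflexive (sym len)))) ⟩
  take (suc k) (drop m (a ∷ x) ++ y ++ rest)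
    ≡⟨ take-suc-++-cong (drop m (a ∷ x)) nonempty y-agrees ⟩
  take (suc k) (drop m (a ∷ x) ++ take k x) ∎
  where
    open ≡-Reasoning
    nonempty : 0 < length (drop m (a ∷ x))
    nonempty = subst (0 <_) (sym (length-drop m (a ∷ x))) (m<n⇒0<n∸m (<-≤-trans m<n (≤-reflexive (sym len))))
    y-agrees : take k (y ++ rest) ≡ take k (take k x)
    y-agrees = trans (take-++-≤ k y rest (≤-trans (≤-trans (n≤1+n k) (n≤1+n (suc k))) (≤-reflexive (sym len-y))))
                     (trans (Step-take a x y (suc-injective len) step) (sym (take-take-≤ x ≤-refl)))

segment-zero : (a : ℕ) (x : List ℕ) → length x ≡ suc k → segment k 0 (a ∷ x) ≡ a ∷ take k x
segment-zero {k} a x len = cong (a ∷_) (take-++-≤ k x (take k x) (≤-trans (n≤1+n k) (≤-reflexive (sym len))))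

segment-suc : (j a : ℕ) (x : List ℕ) → length x ≡ suc k → j ≤ k →
  segment k (suc j) (a ∷ x) ≡ drop j x ++ take j x
segment-suc {k} j a x len j≤k = begin
  take (suc k) (drop j x ++ take k x)                   ≡⟨ cong (λ l → take l (drop j x ++ take k x)) (sym len′) ⟩
  take (length (drop j x) + j) (drop j x ++ take k x)   ≡⟨ take-length-+-++ (drop j x) (take k x) j ⟩
  drop j x ++ take j (take k x)                         ≡⟨ cong (drop j x ++_) (take-take-≤ x j≤k) ⟩
  drop j x ++ take j x                                  ∎
  where
    open ≡-Reasoning
    len′ : length (drop j x) + j ≡ suc k
    len′ = trans (cong (_+ j) (trans (length-drop j x) (cong (_∸ j) len))) (m∸n+n≡m (m≤n⇒m≤1+n j≤k))

segment-IsKPerm : (m : ℕ) → m < suc (suc k) → {x : List ℕ} →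
  IsKPerm (suc (suc k)) (suc (suc k)) x → IsKPerm (suc k) (suc (suc k)) (segment k m x)
segment-IsKPerm {k} zero    _         {a ∷ x} (len , bounds , unique) =
  subst (IsKPerm (suc k) (suc (suc k))) (sym (segment-zero a x (suc-injective len)))
    (length-take-≤ (a ∷ x) (≤-trans (n≤1+n (suc k)) (≤-reflexive (sym len))) ,
     take⁺ (suc k) bounds , Unique.take⁺ (suc k) unique)
segment-IsKPerm {k} (suc j) (s≤s j<n) {a ∷ x} (len , _ ∷ bounds , _ ∷ unique) =
  subst (IsKPerm (suc k) (suc (suc k))) (sym (segment-suc j a x (suc-injective len) (s≤s⁻¹ j<n)))
    (IsKPerm-resp-↭ rotated (suc-injective len , bounds , unique))
  where
    open PermutationReasoning
    rotated : x ↭ drop j x ++ take j x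
    rotated = begin
      x                     ≡⟨ sym (take++drop≡id j x) ⟩
      take j x ++ drop j x  ↭⟨ ↭-++-comm (take j x) (drop j x) ⟩
      drop j x ++ take j x  ∎

IsKPerm-∷ : {c : ℕ} {w : List ℕ} → 1 ≤ c × c ≤ n → c ∉ w → IsKPerm k n w → IsKPerm (suc k) n (c ∷ w)
IsKPerm-∷ {w = w} c-bounds c∉w (len , bounds , unique) =
  cong suc len , c-bounds ∷ bounds , ¬Any⇒All¬ w c∉w ∷ unique

segment-surjective : (m : ℕ) → m < suc (suc k) → {w : List ℕ} → IsKPerm (suc k) (suc (suc k)) w →
  ∃ λ x → IsKPerm (suc (suc k)) (suc (suc k)) x × segment k m x ≡ w
segment-surjective m m<n w-perm with IsKPerm⇒missing w-perm
segment-surjective {k} zero _ {w₀ ∷ w} w-perm | c , c-bounds , c∉w =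
  w₀ ∷ w ∷ʳ c ,
  IsKPerm-resp-↭ (↭-sym (↭-++-comm (w₀ ∷ w) [ c ])) (IsKPerm-∷ c-bounds c∉w w-perm) ,
  (begin
    segment k 0 (w₀ ∷ w ∷ʳ c)       ≡⟨ segment-zero w₀ (w ∷ʳ c) (trans (length-∷ʳ w c) (cong suc len)) ⟩
    w₀ ∷ take k (w ∷ʳ c)            ≡⟨ cong (λ l → w₀ ∷ take l (w ∷ʳ c)) (sym len) ⟩
    w₀ ∷ take (length w) (w ∷ʳ c)   ≡⟨ cong (w₀ ∷_) (take-length-++ w [ c ]) ⟩
    w₀ ∷ w                          ∎)
  where
    open ≡-Reasoning
    len : length w ≡ k
    len = suc-injective (proj₁ w-perm)
segment-surjective {k} (suc j) (s≤s j<1+k) {w} w-perm | c , c-bounds , c∉w =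
  c ∷ D ++ T ,
  IsKPerm-resp-↭ (↭-prep c rotated) (IsKPerm-∷ c-bounds c∉w w-perm) ,
  (begin
    segment k (suc j) (c ∷ D ++ T)
      ≡⟨ segment-suc j c (D ++ T) len (s≤s⁻¹ j<1+k) ⟩
    drop j (D ++ T) ++ take j (D ++ T)
      ≡⟨ cong (λ i → drop i (D ++ T) ++ take i (D ++ T)) (sym len-D) ⟩
    drop (length D) (D ++ T) ++ take (length D) (D ++ T)
      ≡⟨ cong₂ _++_ (drop-length-++ D T) (take-length-++ D T) ⟩
    T ++ D
      ≡⟨ take++drop≡id l w ⟩
    w ∎)
  where
    open ≡-Reasoning
    l = suc k ∸ j
    T = take l w
    D = drop l w
    rotated : w ↭ D ++ T
    rotated = ↭-trans (↭-reflexive (sym (take++drop≡id l w))) (↭-++-comm T D)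
    len : length (D ++ T) ≡ suc k
    len = trans (↭-length (↭-sym rotated)) (proj₁ w-perm)
    len-D : length D ≡ j
    len-D = trans (length-drop l w) (trans (cong (_∸ l) (proj₁ w-perm)) (m∸[m∸n]≡n (<⇒≤ j<1+k)))

∈-windows⁻ : {n m : ℕ} {w : List ℕ} → w ∈ windows n m →
  ∃ λ i → i < n ! × w ≡ window (flat n) (m + suc i * n) (n ∸ 1)
∈-windows⁻ w∈ with ∈-map⁻ _ w∈
... | _ , i+1∈ , refl with ∈-map⁻ suc i+1∈
...   | i , i∈ , refl = i , ∈-upTo⁻ i∈ , refl

∈-windows⁺ : {n m i : ℕ} → i < n ! → window (flat n) (m + suc i * n) (n ∸ 1) ∈ windows n m
∈-windows⁺ {n} {m} i<n! =
  ∈-map⁺ (λ i → window (flat n) (m + i * n) (n ∸ 1)) (∈-map⁺ suc (∈-upTo⁺ i<n!))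

module _ {k m : ℕ} (m<n : m < suc (suc k)) where
  private
    N : ℕ
    N = suc (suc k)
    L : List (List ℕ)
    L = Π N
    lengths : All (λ x → length x ≡ N) L
    lengths = All.map proj₁ (Π-IsKPerm (suc k))
    2≤N! : 2 ≤ N !
    2≤N! = *-mono-≤ (s≤s (s≤s (z≤n {k}))) (1≤n! (suc k))

  window-bound : {i : ℕ} → i < N ! → m + suc i * N + suc k ≤ length (flat N) + length (flat N)
  window-bound {i} i<N! = begin
    m + suc i * N + suc k    ≡⟨ +-assoc m _ (suc k) ⟩
    m + (suc i * N + suc k)  ≡⟨ cong (m +_) (+-comm (suc i * N) (suc k)) ⟩
    m + (suc k + suc i * N)  ≡⟨ sym (+-assoc m (suc k) _) ⟩
    (m + suc k) + suc i * N  ≤⟨ +-mono-≤ (+-mono-≤ (<⇒≤ m<n) (n≤1+n (suc k))) (*-monoˡ-≤ N i<N!) ⟩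
    (N + N) + N ! * N        ≡⟨ cong (λ l → (N + l) + N ! * N) (sym (+-identityʳ N)) ⟩
    2 * N + N ! * N          ≤⟨ +-monoˡ-≤ (N ! * N) (*-monoˡ-≤ N 2≤N!) ⟩
    N ! * N + N ! * N        ≡⟨ sym (cong₂ _+_ len-F len-F) ⟩
    length F + length F      ∎
    where
      open ≤-Reasoning
      F = flat N
      len-F : length F ≡ N ! * N
      len-F = trans (length-concat L lengths) (cong (_* N) (length-Π (suc k)))

  window-flat : {i : ℕ} {x : List ℕ} {rest : List (List ℕ)} →
    i < N ! → drop (suc i) (L ++ L) ≡ x ∷ rest →
    window (flat N) (m + suc i * N) (suc k) ≡ segment k m x
  window-flat {i} {x} {rest} i<N! eq
    with LinkedCyclic-drop-suc L (Π-LinkedCyclic k) (subst (2 ≤_) (sym (length-Π (suc k))) 2≤N!)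
                               (subst (i <_) (sym (length-Π (suc k))) i<N!) eq
  ... | y , rest′ , refl , step = begin
    window F (m + suc i * N) (suc k)
      ≡⟨ window-take-drop F (m + suc i * N) (suc k) (window-bound i<N!) ⟩
    take (suc k) (drop (m + suc i * N) (F ++ F))
      ≡⟨ cong (λ s → take (suc k) (drop s (F ++ F))) (+-comm m (suc i * N)) ⟩
    take (suc k) (drop (suc i * N + m) (F ++ F))
      ≡⟨ cong (take (suc k) ∘ drop (suc i * N + m)) (concat-++ L L) ⟩
    take (suc k) (drop (suc i * N + m) (concat (L ++ L)))
      ≡⟨ cong (take (suc k)) (sym (drop-drop (suc i * N) m (concat (L ++ L)))) ⟩
    take (suc k) (drop m (drop (suc i * N) (concat (L ++ L))))
      ≡⟨ cong (take (suc k) ∘ drop m) (drop-*-concat (suc i) (L ++ L) (++⁺ lengths lengths)) ⟩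
    take (suc k) (drop m (concat (drop (suc i) (L ++ L))))
      ≡⟨ cong (take (suc k) ∘ drop m ∘ concat) eq ⟩
    take (suc k) (drop m (x ++ y ++ concat rest′))
      ≡⟨ take-drop-Step m m<n x y (concat rest′) len-x len-y step ⟩
    segment k m x ∎
    where
      open ≡-Reasoning
      F = flat N
      around : All (λ z → length z ≡ N) (x ∷ y ∷ rest′)
      around = subst (All _) eq (drop⁺ (suc i) (++⁺ lengths lengths))
      len-x : length x ≡ N
      len-x = All.head around
      len-y : length y ≡ N
      len-y = All.head (All.tail around)

  windows-segment : {w : List ℕ} → w ∈ windows N m → ∃ λ x → x ∈ L × w ≡ segment k m x
  windows-segment w∈ with ∈-windows⁻ w∈
  ... | i , i<N! , refl with drop-suc-++-self L (subst (i <_) (sym (length-Π (suc k))) i<N!)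
  ...   | x , _ , eq , x∈L = x , x∈L , window-flat i<N! eq

  segment-∈-windows : {x : List ℕ} → x ∈ L → segment k m x ∈ windows N m
  segment-∈-windows x∈L with ∈⇒drop-suc-++-self x∈L
  ... | i , i<|L| , _ , eq = subst (_∈ windows N m) (window-flat i<N! eq) (∈-windows⁺ i<N!)
    where
      i<N! : i < N !
      i<N! = subst (i <_) (length-Π (suc k)) i<|L|

theorem2 : (n : ℕ) → 2 ≤ n → (m : ℕ) → m < n →
    ((w : List ℕ) → w ∈ windows n m → IsKPerm (n ∸ 1) n w) ×
    ((w : List ℕ) → IsKPerm (n ∸ 1) n w → w ∈ windows n m)
theorem2 (suc zero)    (s≤s ())
theorem2 (suc (suc k)) _        m m<n = sound , complete
  where
    sound : (w : List ℕ) → w ∈ windows (suc (suc k)) m → IsKPerm (suc k) (suc (suc k)) w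
    sound w w∈ with windows-segment m<n w∈
    ... | x , x∈Π , refl = segment-IsKPerm m m<n (All.lookup (Π-IsKPerm (suc k)) x∈Π)

    complete : (w : List ℕ) → IsKPerm (suc k) (suc (suc k)) w → w ∈ windows (suc (suc k)) m
    complete w w-perm with segment-surjective m m<n w-perm
    ... | x , x-perm , refl = segment-∈-windows m<n (Π-complete (suc k) x-perm)
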